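{- Let $r,\ell\ge1$ and $N\ge 2r+1$. Then the induced map $\partial^{(\ell)}_{2r+1}$ takes values in $\mathcal B^1\otimes\operatorname{gr}^F_{\ell-1}(\mathcal B_{2,3})_{N-2r-1}$: $$\partial^{(\ell)}_{2r+1}:\operatorname{gr}^F_\ell(\mathcal B_{2,3})_N\longrightarrow\mathcal B^1\otimes\operatorname{gr}^F_{\ell-1}(\mathcal B_{2,3})_{N-2r-1}.$$
   Context: Let $X=\{x_0,x_1\}$ and let $\mathbb Q\langle X\rangle$ be the free non-commutative $\mathbb Q$-algebra on $X$, with word basis, empty word $\mathbf 1$ and weight equal to length. Write $\mathbb Q\langle X\rangle_m$ for its weight-$m$ part. Let $S(\varepsilon_1\cdots\varepsilon_n)=(-1)^n\varepsilon_n\cdots\varepsilon_1$. For $a,b\in X$ and $f\in\mathbb Q\langle X\rangle$ set $I(a;f;b)=f$ if $(a,b)=(x_1,x_0)$, $S(f)$ if $(a,b)=(x_0,x_1)$, and $(\text{coefficient of }\mathbf 1\text{ in }f)\,\mathbf 1$ if $a=b$. For $r\ge1$ define $\partial_{2r+1}:\mathbb Q\langle X\rangle\to\mathbb Q\langle X\rangle_{2r+1}\otimes\mathbb Q\langle X\rangle$ on words $w=\varepsilon_1\cdots\varepsilon_N$ by $$\partial_{2r+1}(w)=\sum_{j=0}^{N-2r-1}I(\varepsilon_j;\varepsilon_{j+1}\cdots\varepsilon_{j+2r+1};\varepsilon_{j+2r+2})\otimes\varepsilon_1\cdots\varepsilon_j\varepsilon_{j+2r+2}\cdots\varepsilon_N,$$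 with $\varepsilon_0=x_1$ and $\varepsilon_{N+1}=x_0$. Let $\mathcal B_{2,3}\subset\mathbb Q\langle X\rangle$ be the span of all words that are concatenations of the blocks $x_0x_1$ and $x_0x_0x_1$. The level of such a word is its number of blocks $x_0x_0x_1$. $F_\ell\mathcal B_{2,3}$ is the span of words of level $\le\ell$. Put $\operatorname{gr}^F_\ell=F_\ell/F_{\ell-1}$ (with $\operatorname{gr}^F_0=F_0$), $\pi^F_\ell$ the projections, and the subscript $N$ denotes weight. One has $\partial_{2r+1}(F_\ell\mathcal B_{2,3})\subseteq\mathbb Q\langle X\rangle_{2r+1}\otimes F_{\ell-1}\mathcal B_{2,3}$. Hence $(\mathrm{id}\otimes\pi^F_{\ell-1})\circ\partial_{2r+1}$ induces a map $$\partial^{(\ell)}_{2r+1}:\operatorname{gr}^F_\ell\mathcal B_{2,3}\to\mathbb Q\langle X\rangle_{2r+1}\otimes\operatorname{gr}^F_{\ell-1}\mathcal B_{2,3}.$$ $\mathcal B^1\subset\mathbb Q\langle X\rangle$ is the span of the words $(x_0x_1)^{r_1}x_0x_0x_1(x_0x_1)^{r_2}$ ($r_1,r_2\ge0$), i.e. the level-one words of $\mathcal B_{2,3}$, which represent $\operatorname{gr}^F_1\mathcal B_{2,3}$, together with the words $(x_0x_1)^rx_0$ ($r\ge0$). -}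

module Defs where

open import Data.Nat using (ℕ; zero; suc; _+_; _*_; _∸_; _≤?_; _<_)
open import Data.Rational using (ℚ; 0ℚ; 1ℚ; -_) renaming (_+_ to _+ℚ_; _*_ to _*ℚ_)
open import Data.List using (List; []; _∷_; _++_; take; drop; length; reverse; concatMap; map; upTo; replicate; foldr; concat)
open import Data.List.Properties using (≡-dec)
open import Data.Product using (_×_; _,_; ∃; ∃-syntax)
open import Data.Sum using (_⊎_)
open import Relation.Binary.PropositionalEquality using (_≡_; refl)
open import Relation.Nullary using (Dec; yes; no; ¬_)
open import Relation.Nullary.Decidable using (⌊_⌋)
open import Data.Bool using (Bool; true; false; if_then_else_; _∧_)

data Letter : Set where
  x₀ x₁ : Letter

_≟L_ : (a b : Letter) → Dec (a ≡ b)
x₀ ≟L x₀ = yes refl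
x₀ ≟L x₁ = no λ ()
x₁ ≟L x₀ = no λ ()
x₁ ≟L x₁ = yes refl

-- Words (basis of ℚ⟨X⟩); the empty list is the empty word 𝟏; weight = length.
Word : Set
Word = List Letter

_≟W_ : (u v : Word) → Dec (u ≡ v)
_≟W_ = ≡-dec _≟L_

-- Elements of ℚ⟨X⟩ as finite formal ℚ-linear combinations of words.
Poly : Set
Poly = List (ℚ × Word)

-- Elements of ℚ⟨X⟩ ⊗ ℚ⟨X⟩ as finite formal combinations of pairs of words
-- (u ⊗ v), pairs of words being a basis of the tensor product.
Tensor : Set
Tensor = List (ℚ × Word × Word)

coeff : Tensor → Word → Word → ℚ
coeff [] u v = 0ℚ
coeff ((q , u' , v') ∷ t) u v =
  (if ⌊ u' ≟W u ⌋ ∧ ⌊ v' ≟W v ⌋ then q else 0ℚ) +ℚ coeff t u v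

signℚ : ℕ → ℚ
signℚ zero = 1ℚ
signℚ (suc n) = - signℚ n

S : Word → Poly
S w = (signℚ (length w) , reverse w) ∷ []

const𝟏 : Word → Poly
const𝟏 [] = (1ℚ , []) ∷ []
const𝟏 (_ ∷ _) = []

I : Letter → Word → Letter → Poly
I x₁ f x₀ = (1ℚ , f) ∷ []
I x₀ f x₁ = S f
I x₀ f x₀ = const𝟏 f
I x₁ f x₁ = const𝟏 f

-- letter at position i of a list (default x₀ out of range; never used in range below)
at : Word → ℕ → Letter
at [] _ = x₀
at (a ∷ _) zero = a
at (_ ∷ w) (suc i) = at w i

-- the j-th summand of ∂_{m} (m = 2r+1) on w = ε₁⋯ε_N, using ε₀ = x₁, ε_{N+1} = x₀
∂term : ℕ → Word → ℕ → Tensor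
∂term m w j = map (λ { (q , f) → (q , f , take j w ++ drop (j + m) w) })
                  (I (at ext j) (take m (drop (suc j) ext)) (at ext (suc (j + m))))
  where
  ext : Word
  ext = x₁ ∷ (w ++ (x₀ ∷ []))

∂word : ℕ → Word → Tensor
∂word m w with m Data.Nat.≤? length w
... | yes _ = concatMap (∂term m w) (upTo (suc (length w ∸ m)))
... | no _  = []

∂ : ℕ → Poly → Tensor
∂ m p = concatMap (λ { (q , w) → map (λ { (c , u , v) → (q *ℚ c , u , v) }) (∂word m w) }) p

data Block : Set where
  b2 b3 : Block

blockWord : Block → Word
blockWord b2 = x₀ ∷ x₁ ∷ []
blockWord b3 = x₀ ∷ x₀ ∷ x₁ ∷ []

blocksWord : List Block → Word
blocksWord bs = concat (map blockWord bs)

count3 : List Block → ℕ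
count3 [] = 0
count3 (b2 ∷ bs) = count3 bs
count3 (b3 ∷ bs) = suc (count3 bs)

IsBWordOfLevel : ℕ → Word → Set
IsBWordOfLevel k w = ∃[ bs ] (blocksWord bs ≡ w × count3 bs ≡ k)

data InFℓN (ℓ N : ℕ) : Poly → Set where
  []  : InFℓN ℓ N []
  _∷_ : ∀ {q w p} → (∃[ k ] (k Data.Nat.≤ ℓ × IsBWordOfLevel k w)) × length w ≡ N →
        InFℓN ℓ N p → InFℓN ℓ N ((q , w) ∷ p)

IsB1Word : Word → Set
IsB1Word w =
  (∃[ r₁ ] ∃[ r₂ ] w ≡ blocksWord (replicate r₁ b2 ++ b3 ∷ replicate r₂ b2))
  ⊎ (∃[ r ] w ≡ blocksWord (replicate r b2) ++ (x₀ ∷ []))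

-- On block words the level (number of x₀x₀x₁ blocks) is the excess #x₀ − #x₁, which is additive.
-- A summand I(ε_j; M; ε_{j+2r+2}) ⊗ P Q of ∂_{2r+1} w, for a block word w = P M Q, vanishes
-- unless the neighbours of M are (x₁, x₀) or (x₀, x₁).  Going through the ways a block word can be
-- cut, in those cases P Q is again a block word and the left factor (M or its reverse) is a block
-- word, possibly followed by an x₀ taken from an x₀x₀x₁ block.  By additivity the level drops by
-- the excess d of M, which is positive since M has odd length; when d = 1 the left factor is one
-- of the basis words of B¹, and when d ≥ 2 the term lies in F_{ℓ-2}.

module Submission where

open import Defs
open import Algebra.Properties.CommutativeSemigroup using (x∙yz≈y∙xz)
open import Data.Empty using (⊥-elim)
open import Data.Integer as ℤ using (ℤ)
import Data.Integer.Properties as ℤₚ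
open import Data.List using (List; []; _∷_; _++_; _∷ʳ_; take; drop; length; reverse; replicate)
open import Data.List.Membership.Propositional using (_∈_)
open import Data.List.Properties using (++-assoc; ++-identityʳ; ∷-injectiveʳ; length-++; drop-drop; unfold-reverse; reverse-++)
open import Data.List.Relation.Binary.Permutation.Propositional as ↭ using (_↭_; ↭-refl)
open import Data.List.Relation.Binary.Permutation.Propositional.Properties using (↭-reverse; ↭-length; shifts)
open import Data.List.Relation.Unary.All as All using (All; []; _∷_)
open import Data.List.Relation.Unary.All.Properties using (concat⁺; map⁺; ++⁺; applyUpTo⁺₁)
open import Data.List.Relation.Unary.Any using (here; there)
open import Data.Nat using (ℕ; zero; suc; _+_; _*_; _∸_; _≤_; _<_; _≤?_; _<?_; z≤n; s≤s; s≤s⁻¹)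
open import Data.Nat.Properties
  using (+-identityʳ; +-comm; suc-injective; ≤-trans; ≤-antisym; ≮⇒≥; n≤0⇒n≡0; m≤n+m; +-cancelʳ-≤;
         m+n∸m≡n; m≤o∸n⇒m+n≤o; even≢odd)
open import Data.Nat.Tactic.RingSolver using (solve-∀)
open import Data.Product using (_×_; _,_; ∃; ∃-syntax; proj₂; map₂)
open import Data.Rational using (ℚ; 0ℚ)
import Data.Rational.Properties as ℚₚ
open import Data.Sum using (_⊎_; inj₁; inj₂)
open import Function using (id; _∘_)
open import Relation.Binary.PropositionalEquality
open import Relation.Nullary using (¬_; yes; no)

open ≡-Reasoning

splitAt-≤ : ∀ {A : Set} n (xs : List A) → n ≤ length xs →
            ∃[ ys ] ∃[ zs ] (xs ≡ ys ++ zs × length ys ≡ n)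
splitAt-≤ zero    xs       _         = [] , xs , refl , refl
splitAt-≤ (suc n) (x ∷ xs) (s≤s n≤) with splitAt-≤ n xs n≤
... | ys , zs , refl , refl = x ∷ ys , zs , refl , refl

split₃ : ∀ {A : Set} j m (xs : List A) → j + m ≤ length xs →
         ∃[ P ] ∃[ M ] ∃[ Q ] (xs ≡ P ++ M ++ Q × length P ≡ j × length M ≡ m)
split₃ zero    m xs       m≤ with splitAt-≤ m xs m≤
... | M , Q , refl , refl = [] , M , Q , refl , refl , refl
split₃ (suc j) m (x ∷ xs) j+m≤ with split₃ j m xs (s≤s⁻¹ j+m≤)
... | P , M , Q , refl , refl , refl = x ∷ P , M , Q , refl , refl , refl

take-length-++ : ∀ {A : Set} (xs ys : List A) → take (length xs) (xs ++ ys) ≡ xs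
take-length-++ []       ys = refl
take-length-++ (x ∷ xs) ys = cong (x ∷_) (take-length-++ xs ys)

drop-length-++ : ∀ {A : Set} (xs ys : List A) → drop (length xs) (xs ++ ys) ≡ ys
drop-length-++ []       ys = refl
drop-length-++ (x ∷ xs) ys = drop-length-++ xs ys

at-length-++ : ∀ (xs ys : Word) n → at (xs ++ ys) (length xs + n) ≡ at ys n
at-length-++ []       ys n = refl
at-length-++ (x ∷ xs) ys n = at-length-++ xs ys n

-- lastOr x₁ P and headOr x₀ Q are the neighbours ε_j and ε_{j+m+1} of M in x₁ P M Q x₀.
lastOr : Letter → Word → Letter
lastOr a []      = a
lastOr a (b ∷ w) = lastOr b w

headOr : Letter → Word → Letter
headOr a []      = a
headOr a (b ∷ _) = b

lastOr-++-∷ : ∀ a xs y ys → lastOr a (xs ++ y ∷ ys) ≡ lastOr y ys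
lastOr-++-∷ a []       y ys = refl
lastOr-++-∷ a (x ∷ xs) y ys = lastOr-++-∷ x xs y ys

at-lastOr : ∀ a (xs ys : Word) → at (a ∷ xs ++ ys) (length xs) ≡ lastOr a xs
at-lastOr a []       ys = refl
at-lastOr a (x ∷ xs) ys = at-lastOr x xs ys

at-headOr : ∀ (xs ys : Word) → at (xs ++ ys ++ x₀ ∷ []) (length xs) ≡ headOr x₀ ys
at-headOr []       []      = refl
at-headOr []       (y ∷ _) = refl
at-headOr (x ∷ xs) ys      = at-headOr xs ys

OnFactors : (Word → Word → Set) → ℚ × Word × Word → Set
OnFactors R (_ , u , v) = R u v

AllSummands : (Word → Word → Set) → ℕ → Word → Set
AllSummands R m w = ∀ P M Q → w ≡ P ++ M ++ Q → length M ≡ m →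
  All (λ t → R (proj₂ t) (P ++ Q)) (I (lastOr x₁ P) M (headOr x₀ Q))

∂term-all : ∀ {R} P M Q → All (λ t → R (proj₂ t) (P ++ Q)) (I (lastOr x₁ P) M (headOr x₀ Q)) →
            All (OnFactors R) (∂term (length M) (P ++ M ++ Q) (length P))
∂term-all {R} P M Q terms
  rewrite ++-assoc P (M ++ Q) (x₀ ∷ [])
        | ++-assoc M Q (x₀ ∷ [])
        | at-lastOr x₁ P (M ++ Q ++ x₀ ∷ [])
        | drop-length-++ P (M ++ Q ++ x₀ ∷ [])
        | take-length-++ M (Q ++ x₀ ∷ [])
        | at-length-++ P (M ++ Q ++ x₀ ∷ []) (length M)
        | at-headOr M Q
  = map⁺ (All.map (subst (R _) (sym excised)) terms)
  where
  excised : take (length P) (P ++ M ++ Q) ++ drop (length P + length M) (P ++ M ++ Q) ≡ P ++ Q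
  excised rewrite take-length-++ P (M ++ Q)
                | sym (drop-drop (length P) (length M) (P ++ M ++ Q))
                | drop-length-++ P (M ++ Q)
                | drop-length-++ M Q = refl

∂term-all-at : ∀ {R} m w j → j + m ≤ length w → AllSummands R m w → All (OnFactors R) (∂term m w j)
∂term-all-at m w j bound summands with split₃ j m w bound
... | P , M , Q , refl , refl , refl = ∂term-all P M Q (summands P M Q refl refl)

∂word-all : ∀ {R} m w → AllSummands R m w → All (OnFactors R) (∂word m w)
∂word-all m w summands with m ≤? length w
... | no _   = []
... | yes m≤ = concat⁺ (map⁺ (applyUpTo⁺₁ id (suc (length w ∸ m))
                 (λ {j} j< → ∂term-all-at m w j (m≤o∸n⇒m+n≤o j m≤ (s≤s⁻¹ j<)) summands)))

∂-all : ∀ {R} m p → All (λ t → AllSummands R m (proj₂ t)) p → All (OnFactors R) (∂ m p)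
∂-all m []            []                = []
∂-all m ((q , w) ∷ p) (summands ∷ rest) = ++⁺ (map⁺ (∂word-all m w summands)) (∂-all m p rest)

blocksWord-++ : ∀ xs ys → blocksWord (xs ++ ys) ≡ blocksWord xs ++ blocksWord ys
blocksWord-++ []       ys = refl
blocksWord-++ (b ∷ xs) ys = begin
  blockWord b ++ blocksWord (xs ++ ys)             ≡⟨ cong (blockWord b ++_) (blocksWord-++ xs ys) ⟩
  blockWord b ++ blocksWord xs ++ blocksWord ys    ≡⟨ ++-assoc (blockWord b) _ _ ⟨
  (blockWord b ++ blocksWord xs) ++ blocksWord ys  ∎

blocksWord-inside : ∀ bs₁ b bs₂ {s t} → blockWord b ≡ s ++ t →
                    blocksWord (bs₁ ++ b ∷ bs₂) ≡ (blocksWord bs₁ ++ s) ++ t ++ blocksWord bs₂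
blocksWord-inside bs₁ b bs₂ {s} {t} b≡ = begin
  blocksWord (bs₁ ++ b ∷ bs₂)                   ≡⟨ blocksWord-++ bs₁ (b ∷ bs₂) ⟩
  blocksWord bs₁ ++ blockWord b ++ blocksWord bs₂ ≡⟨ cong (λ x → blocksWord bs₁ ++ x ++ blocksWord bs₂) b≡ ⟩
  blocksWord bs₁ ++ (s ++ t) ++ blocksWord bs₂    ≡⟨ cong (blocksWord bs₁ ++_) (++-assoc s t _) ⟩
  blocksWord bs₁ ++ s ++ t ++ blocksWord bs₂      ≡⟨ ++-assoc (blocksWord bs₁) s _ ⟨
  (blocksWord bs₁ ++ s) ++ t ++ blocksWord bs₂    ∎

length-blocksWord : ∀ bs → length (blocksWord bs) ≡ 2 * length bs + count3 bs
length-blocksWord []        = refl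
length-blocksWord (b2 ∷ bs) = trans (cong (2 +_) (length-blocksWord bs)) (arith (length bs) (count3 bs))
  where
  arith : ∀ a c → 2 + (2 * a + c) ≡ 2 * suc a + c
  arith = solve-∀
length-blocksWord (b3 ∷ bs) = trans (cong (3 +_) (length-blocksWord bs)) (arith (length bs) (count3 bs))
  where
  arith : ∀ a c → 3 + (2 * a + c) ≡ 2 * suc a + suc c
  arith = solve-∀

lastOr-blocksWord : ∀ bs → lastOr x₁ (blocksWord bs) ≡ x₁
lastOr-blocksWord []        = refl
lastOr-blocksWord (b2 ∷ bs) = lastOr-blocksWord bs
lastOr-blocksWord (b3 ∷ bs) = lastOr-blocksWord bs

headOr-blocksWord : ∀ bs → headOr x₀ (blocksWord bs) ≡ x₀
headOr-blocksWord []       = refl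
headOr-blocksWord (b2 ∷ _) = refl
headOr-blocksWord (b3 ∷ _) = refl

reverse-blocksWord : ∀ bs → reverse (blocksWord bs) ∷ʳ x₁ ≡ x₁ ∷ blocksWord (reverse bs)
reverse-blocksWord []       = refl
reverse-blocksWord (b ∷ bs) = begin
  reverse (blockWord b ++ blocksWord bs) ∷ʳ x₁                ≡⟨ cong (_∷ʳ x₁) (reverse-++ (blockWord b) (blocksWord bs)) ⟩
  (reverse (blocksWord bs) ++ reverse (blockWord b)) ∷ʳ x₁    ≡⟨ ++-assoc (reverse (blocksWord bs)) _ _ ⟩
  reverse (blocksWord bs) ++ reverse (blockWord b) ∷ʳ x₁      ≡⟨ cong (reverse (blocksWord bs) ++_) (reverse-block b) ⟩
  reverse (blocksWord bs) ++ x₁ ∷ blockWord b                 ≡⟨ ++-assoc (reverse (blocksWord bs)) (x₁ ∷ []) _ ⟨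
  (reverse (blocksWord bs) ∷ʳ x₁) ++ blockWord b              ≡⟨ cong (_++ blockWord b) (reverse-blocksWord bs) ⟩
  x₁ ∷ blocksWord (reverse bs) ++ blockWord b                 ≡⟨ cong (λ u → x₁ ∷ blocksWord (reverse bs) ++ u) (++-identityʳ (blockWord b)) ⟨
  x₁ ∷ blocksWord (reverse bs) ++ blocksWord (b ∷ [])         ≡⟨ cong (x₁ ∷_) (blocksWord-++ (reverse bs) (b ∷ [])) ⟨
  x₁ ∷ blocksWord (reverse bs ∷ʳ b)                           ≡⟨ cong (λ bs′ → x₁ ∷ blocksWord bs′) (unfold-reverse b bs) ⟨
  x₁ ∷ blocksWord (reverse (b ∷ bs))                          ∎
  where
  reverse-block : ∀ b → reverse (blockWord b) ∷ʳ x₁ ≡ x₁ ∷ blockWord b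
  reverse-block b2 = refl
  reverse-block b3 = refl

reverse-inside : ∀ b D {s} → reverse s ∷ʳ x₁ ≡ blockWord b →
                 reverse (x₁ ∷ blocksWord D ++ s) ≡ blocksWord (b ∷ reverse D)
reverse-inside b D {s} b≡ = begin
  reverse (x₁ ∷ blocksWord D ++ s)                   ≡⟨ unfold-reverse x₁ (blocksWord D ++ s) ⟩
  reverse (blocksWord D ++ s) ∷ʳ x₁                  ≡⟨ cong (_∷ʳ x₁) (reverse-++ (blocksWord D) s) ⟩
  (reverse s ++ reverse (blocksWord D)) ∷ʳ x₁        ≡⟨ ++-assoc (reverse s) _ _ ⟩
  reverse s ++ reverse (blocksWord D) ∷ʳ x₁          ≡⟨ cong (reverse s ++_) (reverse-blocksWord D) ⟩
  reverse s ++ x₁ ∷ blocksWord (reverse D)           ≡⟨ ++-assoc (reverse s) (x₁ ∷ []) _ ⟨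
  (reverse s ∷ʳ x₁) ++ blocksWord (reverse D)        ≡⟨ cong (_++ blocksWord (reverse D)) b≡ ⟩
  blockWord b ++ blocksWord (reverse D)              ∎

data Cut : List Block → Word → Word → Set where
  between    : ∀ bs₁ bs₂ → Cut (bs₁ ++ bs₂) (blocksWord bs₁) (blocksWord bs₂)
  inside-b2  : ∀ bs₁ bs₂ → Cut (bs₁ ++ b2 ∷ bs₂) (blocksWord bs₁ ++ x₀ ∷ []) (x₁ ∷ blocksWord bs₂)
  inside-b3  : ∀ bs₁ bs₂ → Cut (bs₁ ++ b3 ∷ bs₂) (blocksWord bs₁ ++ x₀ ∷ []) (x₀ ∷ x₁ ∷ blocksWord bs₂)
  inside-b3′ : ∀ bs₁ bs₂ → Cut (bs₁ ++ b3 ∷ bs₂) (blocksWord bs₁ ++ x₀ ∷ x₀ ∷ []) (x₁ ∷ blocksWord bs₂)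

cut-∷ : ∀ b {bs P R} → Cut bs P R → Cut (b ∷ bs) (blockWord b ++ P) R
cut-∷ b  (between bs₁ bs₂)    = between (b ∷ bs₁) bs₂
cut-∷ b2 (inside-b2 bs₁ bs₂)  = inside-b2 (b2 ∷ bs₁) bs₂
cut-∷ b3 (inside-b2 bs₁ bs₂)  = inside-b2 (b3 ∷ bs₁) bs₂
cut-∷ b2 (inside-b3 bs₁ bs₂)  = inside-b3 (b2 ∷ bs₁) bs₂
cut-∷ b3 (inside-b3 bs₁ bs₂)  = inside-b3 (b3 ∷ bs₁) bs₂
cut-∷ b2 (inside-b3′ bs₁ bs₂) = inside-b3′ (b2 ∷ bs₁) bs₂
cut-∷ b3 (inside-b3′ bs₁ bs₂) = inside-b3′ (b3 ∷ bs₁) bs₂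

cut : ∀ bs P R → blocksWord bs ≡ P ++ R → Cut bs P R
cut []        []                     R refl = between [] []
cut (b ∷ bs)  []                     R refl = between [] (b ∷ bs)
cut (b2 ∷ bs) (x₀ ∷ [])              R refl = inside-b2 [] bs
cut (b2 ∷ bs) (x₀ ∷ x₁ ∷ P)          R eq   = cut-∷ b2 (cut bs P R (∷-injectiveʳ (∷-injectiveʳ eq)))
cut (b3 ∷ bs) (x₀ ∷ [])              R refl = inside-b3 [] bs
cut (b3 ∷ bs) (x₀ ∷ x₀ ∷ [])         R refl = inside-b3′ [] bs
cut (b3 ∷ bs) (x₀ ∷ x₀ ∷ x₁ ∷ P)     R eq   =
  cut-∷ b3 (cut bs P R (∷-injectiveʳ (∷-injectiveʳ (∷-injectiveʳ eq))))
cut [] (_ ∷ _) R ()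
cut (b2 ∷ bs) (x₁ ∷ P) R ()
cut (b2 ∷ bs) (x₀ ∷ x₀ ∷ P) R ()
cut (b3 ∷ bs) (x₁ ∷ P) R ()
cut (b3 ∷ bs) (x₀ ∷ x₁ ∷ P) R ()
cut (b3 ∷ bs) (x₀ ∷ x₀ ∷ x₀ ∷ P) R ()

-- Level as excess of x₀ over x₁

letterExcess : Letter → ℤ
letterExcess x₀ = ℤ.1ℤ
letterExcess x₁ = ℤ.-1ℤ

excess : Word → ℤ
excess []      = ℤ.0ℤ
excess (a ∷ w) = letterExcess a ℤ.+ excess w

excess-++ : ∀ xs ys → excess (xs ++ ys) ≡ excess xs ℤ.+ excess ys
excess-++ []       ys = sym (ℤₚ.+-identityˡ (excess ys))
excess-++ (x ∷ xs) ys = begin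
  letterExcess x ℤ.+ excess (xs ++ ys)               ≡⟨ cong (λ e → letterExcess x ℤ.+ e) (excess-++ xs ys) ⟩
  letterExcess x ℤ.+ (excess xs ℤ.+ excess ys)       ≡⟨ ℤₚ.+-assoc (letterExcess x) _ _ ⟨
  letterExcess x ℤ.+ excess xs ℤ.+ excess ys         ∎

excess-↭ : ∀ {xs ys} → xs ↭ ys → excess xs ≡ excess ys
excess-↭ ↭.refl                      = refl
excess-↭ (↭.prep x p)                = cong (λ e → letterExcess x ℤ.+ e) (excess-↭ p)
excess-↭ {x ∷ y ∷ xs} (↭.swap x y p) = trans
  (x∙yz≈y∙xz ℤₚ.+-commutativeSemigroup (letterExcess x) (letterExcess y) (excess xs))
  (cong (λ e → letterExcess y ℤ.+ (letterExcess x ℤ.+ e)) (excess-↭ p))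
excess-↭ (↭.trans p q)               = trans (excess-↭ p) (excess-↭ q)

excess-blocksWord : ∀ bs → excess (blocksWord bs) ≡ ℤ.+ count3 bs
excess-blocksWord []       = refl
excess-blocksWord (b ∷ bs) = begin
  excess (blockWord b ++ blocksWord bs)          ≡⟨ excess-++ (blockWord b) (blocksWord bs) ⟩
  excess (blockWord b) ℤ.+ excess (blocksWord bs) ≡⟨ cong (λ e → excess (blockWord b) ℤ.+ e) (excess-blocksWord bs) ⟩
  excess (blockWord b) ℤ.+ ℤ.+ count3 bs          ≡⟨ excess-block b ⟩
  ℤ.+ count3 (b ∷ bs)                             ∎
  where
  excess-block : ∀ b → excess (blockWord b) ℤ.+ ℤ.+ count3 bs ≡ ℤ.+ count3 (b ∷ bs)
  excess-block b2 = refl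
  excess-block b3 = refl

-- The index is the level lost by excising the word; the trailing x₀ of blocks-x₀ comes from an x₀x₀x₁ block.
data Chunk : ℕ → Word → Set where
  blocks    : ∀ D → Chunk (count3 D) (blocksWord D)
  blocks-x₀ : ∀ D → Chunk (suc (count3 D)) (blocksWord D ++ x₀ ∷ [])

chunk-excess : ∀ {d u} → Chunk d u → excess u ≡ ℤ.+ d
chunk-excess (blocks D)    = excess-blocksWord D
chunk-excess (blocks-x₀ D) = begin
  excess (blocksWord D ++ x₀ ∷ [])             ≡⟨ excess-++ (blocksWord D) (x₀ ∷ []) ⟩
  excess (blocksWord D) ℤ.+ ℤ.+ 1              ≡⟨ cong (λ e → e ℤ.+ ℤ.+ 1) (excess-blocksWord D) ⟩
  ℤ.+ (count3 D + 1)                           ≡⟨ cong ℤ.+_ (+-comm (count3 D) 1) ⟩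
  ℤ.+ suc (count3 D)                           ∎

chunk-odd⇒level≥1 : ∀ {d u} n → Chunk d u → length u ≡ 2 * n + 1 → 1 ≤ d
chunk-odd⇒level≥1 n (blocks D) odd with count3 D | length-blocksWord D
... | suc _ | _   = s≤s z≤n
... | zero  | len = ⊥-elim (even≢odd (length D) n (begin
  2 * length D            ≡⟨ +-identityʳ (2 * length D) ⟨
  2 * length D + 0        ≡⟨ len ⟨
  length (blocksWord D)   ≡⟨ odd ⟩
  2 * n + 1               ≡⟨ +-comm (2 * n) 1 ⟩
  suc (2 * n)             ∎))
chunk-odd⇒level≥1 n (blocks-x₀ D) _ = s≤s z≤n

count3≡0⇒all-b2 : ∀ bs → count3 bs ≡ 0 → bs ≡ replicate (length bs) b2
count3≡0⇒all-b2 []        _  = refl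
count3≡0⇒all-b2 (b2 ∷ bs) eq = cong (b2 ∷_) (count3≡0⇒all-b2 bs eq)

count3≡1⇒one-b3 : ∀ bs → count3 bs ≡ 1 → ∃[ r₁ ] ∃[ r₂ ] bs ≡ replicate r₁ b2 ++ b3 ∷ replicate r₂ b2
count3≡1⇒one-b3 (b2 ∷ bs) eq with count3≡1⇒one-b3 bs eq
... | r₁ , r₂ , refl = suc r₁ , r₂ , refl
count3≡1⇒one-b3 (b3 ∷ bs) eq = 0 , length bs , cong (b3 ∷_) (count3≡0⇒all-b2 bs (suc-injective eq))

chunk-level≡1⇒B¹ : ∀ {d u} → Chunk d u → d ≡ 1 → IsB1Word u
chunk-level≡1⇒B¹ (blocks D) eq with count3≡1⇒one-b3 D eq
... | r₁ , r₂ , D≡ = inj₁ (r₁ , r₂ , cong blocksWord D≡)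
chunk-level≡1⇒B¹ (blocks-x₀ D) eq =
  inj₂ (length D , cong (λ D′ → blocksWord D′ ++ x₀ ∷ []) (count3≡0⇒all-b2 D (suc-injective eq)))

reversed-chunk : ∀ b D {s} → reverse s ∷ʳ x₁ ≡ blockWord b →
                 Chunk (count3 (b ∷ reverse D)) (reverse (x₁ ∷ blocksWord D ++ s))
reversed-chunk b D b≡ = subst (Chunk _) (sym (reverse-inside b D b≡)) (blocks (b ∷ reverse D))

reversed-chunk-x₀ : ∀ b D {s} → reverse s ∷ʳ x₁ ≡ blockWord b →
                    Chunk (suc (count3 (b ∷ reverse D))) (reverse (x₀ ∷ x₁ ∷ blocksWord D ++ s))
reversed-chunk-x₀ b D {s} b≡ = subst (Chunk _) (sym reversed) (blocks-x₀ (b ∷ reverse D))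
  where
  reversed : reverse (x₀ ∷ x₁ ∷ blocksWord D ++ s) ≡ blocksWord (b ∷ reverse D) ∷ʳ x₀
  reversed = trans (unfold-reverse x₀ (x₁ ∷ blocksWord D ++ s)) (cong (_∷ʳ x₀) (reverse-inside b D b≡))

data Excision (u v : Word) : Set where
  excision : ∀ {d} → Chunk d u → (V : List Block) → blocksWord V ≡ v → Excision u v

Excisions : Word → Poly → Set
Excisions v = All (λ t → Excision (proj₂ t) v)

const𝟏-++-∷ : ∀ xs y ys → const𝟏 (xs ++ y ∷ ys) ≡ []
const𝟏-++-∷ []      _ _ = refl
const𝟏-++-∷ (_ ∷ _) _ _ = refl

excise-between : ∀ bs₁ bs₂ M Q → blocksWord bs₂ ≡ M ++ Q →
                 Excisions (blocksWord bs₁ ++ Q) (I x₁ M (headOr x₀ Q))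
excise-between bs₁ bs₂ M Q eq with cut bs₂ M Q eq
... | between bs₃ bs₄ rewrite headOr-blocksWord bs₄ =
  excision (blocks bs₃) (bs₁ ++ bs₄) (blocksWord-++ bs₁ bs₄) ∷ []
... | inside-b2 bs₃ bs₄ rewrite const𝟏-++-∷ (blocksWord bs₃) x₀ [] = []
... | inside-b3 bs₃ bs₄ =
  excision (blocks-x₀ bs₃) (bs₁ ++ b2 ∷ bs₄) (blocksWord-++ bs₁ (b2 ∷ bs₄)) ∷ []
... | inside-b3′ bs₃ bs₄ rewrite const𝟏-++-∷ (blocksWord bs₃) x₀ (x₀ ∷ []) = []

excise-before-x₁ : ∀ bs₁ b bs₂ {s} → blockWord b ≡ s ++ x₁ ∷ [] → ∀ M Q → x₁ ∷ blocksWord bs₂ ≡ M ++ Q →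
                   Excisions ((blocksWord bs₁ ++ s) ++ Q) (I x₀ M (headOr x₀ Q))
excise-before-x₁ bs₁ b bs₂ b≡ [] Q refl =
  excision (blocks []) (bs₁ ++ b ∷ bs₂) (blocksWord-inside bs₁ b bs₂ b≡) ∷ []
excise-before-x₁ bs₁ b bs₂ b≡ (x₁ ∷ M) Q eq with cut bs₂ M Q (∷-injectiveʳ eq)
... | between bs₃ bs₄ rewrite headOr-blocksWord bs₄ = []
... | inside-b2 bs₃ bs₄ =
  excision (reversed-chunk b2 bs₃ refl) (bs₁ ++ b ∷ bs₄) (blocksWord-inside bs₁ b bs₄ b≡) ∷ []
... | inside-b3 bs₃ bs₄ = []
... | inside-b3′ bs₃ bs₄ =
  excision (reversed-chunk b3 bs₃ refl) (bs₁ ++ b ∷ bs₄) (blocksWord-inside bs₁ b bs₄ b≡) ∷ []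

excise-inside-b3 : ∀ bs₁ bs₂ M Q → x₀ ∷ x₁ ∷ blocksWord bs₂ ≡ M ++ Q →
                   Excisions ((blocksWord bs₁ ++ x₀ ∷ []) ++ Q) (I x₀ M (headOr x₀ Q))
excise-inside-b3 bs₁ bs₂ [] Q refl =
  excision (blocks []) (bs₁ ++ b3 ∷ bs₂) (blocksWord-inside bs₁ b3 bs₂ refl) ∷ []
excise-inside-b3 bs₁ bs₂ (x₀ ∷ []) Q refl =
  excision (blocks-x₀ []) (bs₁ ++ b2 ∷ bs₂) (blocksWord-inside bs₁ b2 bs₂ refl) ∷ []
excise-inside-b3 bs₁ bs₂ (x₀ ∷ x₁ ∷ M) Q eq with cut bs₂ M Q (∷-injectiveʳ (∷-injectiveʳ eq))
... | between bs₃ bs₄ rewrite headOr-blocksWord bs₄ = []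
... | inside-b2 bs₃ bs₄ =
  excision (reversed-chunk-x₀ b2 bs₃ refl) (bs₁ ++ b2 ∷ bs₄) (blocksWord-inside bs₁ b2 bs₄ refl) ∷ []
... | inside-b3 bs₃ bs₄ = []
... | inside-b3′ bs₃ bs₄ =
  excision (reversed-chunk-x₀ b3 bs₃ refl) (bs₁ ++ b2 ∷ bs₄) (blocksWord-inside bs₁ b2 bs₄ refl) ∷ []

excise-at : ∀ {bs P R} M Q → Cut bs P R → R ≡ M ++ Q →
            Excisions (P ++ Q) (I (lastOr x₁ P) M (headOr x₀ Q))
excise-at M Q (between bs₁ bs₂) eq rewrite lastOr-blocksWord bs₁ = excise-between bs₁ bs₂ M Q eq
excise-at M Q (inside-b2 bs₁ bs₂) eq rewrite lastOr-++-∷ x₁ (blocksWord bs₁) x₀ [] =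
  excise-before-x₁ bs₁ b2 bs₂ refl M Q eq
excise-at M Q (inside-b3 bs₁ bs₂) eq rewrite lastOr-++-∷ x₁ (blocksWord bs₁) x₀ [] =
  excise-inside-b3 bs₁ bs₂ M Q eq
excise-at M Q (inside-b3′ bs₁ bs₂) eq rewrite lastOr-++-∷ x₁ (blocksWord bs₁) x₀ (x₀ ∷ []) =
  excise-before-x₁ bs₁ b3 bs₂ refl M Q eq

excise : ∀ bs P M Q → blocksWord bs ≡ P ++ M ++ Q → Excisions (P ++ Q) (I (lastOr x₁ P) M (headOr x₀ Q))
excise bs P M Q w≡ = excise-at M Q (cut bs P (M ++ Q) w≡) refl

I-↭ : ∀ a M b → All (λ t → proj₂ t ↭ M) (I a M b)
I-↭ x₁ M x₀ = ↭-refl ∷ []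
I-↭ x₀ M x₁ = ↭-reverse M ∷ []
I-↭ x₀ M x₀ = const𝟏-↭ M
  where
  const𝟏-↭ : ∀ M → All (λ t → proj₂ t ↭ M) (const𝟏 M)
  const𝟏-↭ []      = ↭-refl ∷ []
  const𝟏-↭ (_ ∷ _) = []
I-↭ x₁ M x₁ = I-↭ x₀ M x₀

excision-level : ∀ bs V P Q {M u d} → blocksWord bs ≡ P ++ M ++ Q → u ↭ M → Chunk d u →
                 blocksWord V ≡ P ++ Q → count3 bs ≡ d + count3 V
excision-level bs V P Q {M} {u} {d} w≡ u↭M chunk v≡ = ℤₚ.+-injective (begin
  ℤ.+ count3 bs                       ≡⟨ excess-blocksWord bs ⟨
  excess (blocksWord bs)              ≡⟨ cong excess w≡ ⟩
  excess (P ++ M ++ Q)                ≡⟨ excess-↭ (shifts P M) ⟩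
  excess (M ++ P ++ Q)                ≡⟨ excess-++ M (P ++ Q) ⟩
  excess M ℤ.+ excess (P ++ Q)        ≡⟨ cong₂ ℤ._+_ (excess-↭ u↭M) (cong excess v≡) ⟨
  excess u ℤ.+ excess (blocksWord V)  ≡⟨ cong₂ ℤ._+_ (chunk-excess chunk) (excess-blocksWord V) ⟩
  ℤ.+ (d + count3 V)                  ∎)

length-excise : ∀ (P M Q : Word) → length (P ++ Q) ≡ length (P ++ M ++ Q) ∸ length M
length-excise P M Q = begin
  length (P ++ Q)                              ≡⟨ m+n∸m≡n (length M) _ ⟨
  length M + length (P ++ Q) ∸ length M        ≡⟨ cong (_∸ length M) (length-++ M) ⟨
  length (M ++ P ++ Q) ∸ length M              ≡⟨ cong (_∸ length M) (↭-length (shifts P M)) ⟨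
  length (P ++ M ++ Q) ∸ length M              ∎

Lower-or-B¹⊗gr : ℕ → ℕ → Word → Word → Set
Lower-or-B¹⊗gr ℓ n u v = (∃ λ k → k < ℓ ∸ 1 × IsBWordOfLevel k v)
                        ⊎ (IsB1Word u × IsBWordOfLevel (ℓ ∸ 1) v × length v ≡ n)

level-drop⇒Lower-or-B¹⊗gr : ∀ {ℓ d n u} V → d + count3 V ≤ ℓ → 1 ≤ d → (d ≡ 1 → IsB1Word u) →
                            length (blocksWord V) ≡ n → Lower-or-B¹⊗gr ℓ n u (blocksWord V)
level-drop⇒Lower-or-B¹⊗gr {ℓ} V _ _ _ _ with count3 V <? ℓ ∸ 1
... | yes lower = inj₁ (count3 V , lower , V , refl , refl)
level-drop⇒Lower-or-B¹⊗gr {suc ℓ} {suc d} V bound _ B¹ len | no ¬lower =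
  inj₂ (B¹ (cong suc d≡0) , (V , refl , k≡ℓ) , len)
  where
  bound′ : d + count3 V ≤ ℓ
  bound′ = s≤s⁻¹ bound
  d≡0 : d ≡ 0
  d≡0 = n≤0⇒n≡0 (+-cancelʳ-≤ (count3 V) d 0 (≤-trans bound′ (≮⇒≥ ¬lower)))
  k≡ℓ : count3 V ≡ ℓ
  k≡ℓ = ≤-antisym (≤-trans (m≤n+m (count3 V) d) bound′) (≮⇒≥ ¬lower)

summands-lower-or-B¹ : ∀ {ℓ} r bs → count3 bs ≤ ℓ →
  AllSummands (Lower-or-B¹⊗gr ℓ (length (blocksWord bs) ∸ (2 * r + 1))) (2 * r + 1) (blocksWord bs)
summands-lower-or-B¹ {ℓ} r bs level≤ P M Q w≡ odd =
  All.map (λ {t} → term {t}) (All.zip (excise bs P M Q w≡ , I-↭ (lastOr x₁ P) M (headOr x₀ Q)))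
  where
  weight : length (P ++ Q) ≡ length (blocksWord bs) ∸ (2 * r + 1)
  weight = trans (length-excise P M Q) (cong₂ _∸_ (cong length (sym w≡)) odd)

  term : ∀ {t : ℚ × Word} → Excision (proj₂ t) (P ++ Q) × proj₂ t ↭ M →
         Lower-or-B¹⊗gr ℓ (length (blocksWord bs) ∸ (2 * r + 1)) (proj₂ t) (P ++ Q)
  term (excision chunk V v≡ , u↭M) = subst (Lower-or-B¹⊗gr ℓ _ _) v≡
    (level-drop⇒Lower-or-B¹⊗gr V
      (subst (_≤ ℓ) (excision-level bs V P Q w≡ u↭M chunk v≡) level≤)
      (chunk-odd⇒level≥1 r chunk (trans (↭-length u↭M) odd))
      (chunk-level≡1⇒B¹ chunk)
      (trans (cong length v≡) weight))

F-summands-lower-or-B¹ : ∀ {ℓ N p} r → InFℓN ℓ N p →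
  All (λ t → AllSummands (Lower-or-B¹⊗gr ℓ (N ∸ (2 * r + 1))) (2 * r + 1) (proj₂ t)) p
F-summands-lower-or-B¹ r []                                                 = []
F-summands-lower-or-B¹ r (((_ , level≤ , bs , refl , refl) , refl) ∷ rest) =
  summands-lower-or-B¹ r bs level≤ ∷ F-summands-lower-or-B¹ r rest

coeff≢0⇒∈ : ∀ t u v → ¬ (coeff t u v ≡ 0ℚ) → ∃[ q ] (q , u , v) ∈ t
coeff≢0⇒∈ [] u v nonzero = ⊥-elim (nonzero refl)
coeff≢0⇒∈ ((q , u′ , v′) ∷ t) u v nonzero with u′ ≟W u | v′ ≟W v
... | yes refl | yes refl = q , here refl
... | yes _    | no _     = map₂ there (coeff≢0⇒∈ t u v (nonzero ∘ trans (ℚₚ.+-identityˡ _)))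
... | no _     | _        = map₂ there (coeff≢0⇒∈ t u v (nonzero ∘ trans (ℚₚ.+-identityˡ _)))

theorem4p9 : (r ℓ N : ℕ) → 1 ≤ r → 1 ≤ ℓ → 2 * r + 1 ≤ N →
    (p : Poly) → InFℓN ℓ N p →
    (u v : Word) → ¬ (coeff (∂ (2 * r + 1) p) u v ≡ 0ℚ) →
      (∃ λ k → k < ℓ ∸ 1 × IsBWordOfLevel k v)
      ⊎ (IsB1Word u × IsBWordOfLevel (ℓ ∸ 1) v × length v ≡ N ∸ (2 * r + 1))
theorem4p9 r ℓ N _ _ _ p p∈F u v nonzero =
  All.lookup (∂-all (2 * r + 1) p (F-summands-lower-or-B¹ r p∈F)) (proj₂ (coeff≢0⇒∈ _ u v nonzero))
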